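{- Let $n$ be an odd positive integer. Then $n\in\mathfrak{P}$ if and only if $\gcd\left(\frac{n-1}{2},p-1\right)<p-1$ for every prime $p$ dividing $n$.
   Context: For an odd positive integer $n$, put $G(n)=\sum_{j=1}^{n-1} j^{(n-1)/2}$. Let $\mathfrak{P}$ denote the set of odd positive integers $n$ such that $G(n)\equiv 0\pmod n$. -}

module Defs where

open import Data.Nat using (ℕ; zero; suc; _+_; _∸_; _^_; _/_)
open import Data.Nat.Divisibility using (_∣_)
open import Data.Product using (∃-syntax)
open import Relation.Binary.PropositionalEquality using (_≡_)

Odd : ℕ → Set
Odd n = ∃[ k ] n ≡ suc (2 * k)
  where open import Data.Nat using (_*_)

powSum : ℕ → ℕ → ℕ
powSum e zero    = 0
powSum e (suc m) = powSum e m + suc m ^ e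

G : ℕ → ℕ
G n = powSum ((n ∸ 1) / 2) (n ∸ 1)

InP : ℕ → Set
InP n = Odd n Data.Product.× (n ∣ G n)
  where import Data.Product

module Submission where

open import Defs
open import Data.Nat using (ℕ; _∸_; _/_; _<_)
open import Data.Nat.Divisibility using (_∣_)
open import Data.Nat.GCD using (gcd)
open import Data.Nat.Primality using (Prime)
open import Function.Bundles using (_⇔_)

-- Write S e m = ∑_{j<m} jᵉ, so that G n = S e n for e = (n-1)/2 (n = 1 is trivial).
-- * Local criterion: for a prime p and e ≥ 1, p ∣ S e p iff (p-1) ∤ e.  The recurrence
--   m^(k+1) = ∑_{i≤k} (k+1 choose i) S i m (telescoping plus the binomial theorem) gives
--   p ∣ S k p for k < p-1 and S (p-1) p ≡ -1 (mod p); by Fermat's little theorem S e p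
--   is periodic in e ≥ 1 with period p-1.
-- * Local–global principle: for odd n, n ∣ S e n iff p ∣ S e p for all primes p ∣ n.
--   Along the prime factorisation, a prime p ∤ u splits off since S e (pu) ≡ u·S e p
--   (mod p) and ≡ p·S e u (mod u); a repeated odd p ∣ u drops out since
--   S e (pu) ≡ p·S e u (mod pu), by expanding (tu + r)ᵉ to first order in tu.
-- * Finally (p-1) ∤ e iff gcd(e, p-1) < p-1.
-- The file develops integer congruences and finite sums, binomial coefficients and
-- Fermat, power sums, the local criterion, the local–global principle, and the theorem.

open import Data.Nat as ℕ using (zero; suc; _≤_; _%_; _!; s≤s; z≤n; NonZero)
import Data.Nat.Properties as ℕₚ
import Data.Nat.Tactic.RingSolver as ℕ-Solver
open import Data.Nat.Combinatorics
  using (_C_; nCk+nC[k+1]≡[n+1]C[k+1]; nCk≡n!/k![n-k]!; k![n∸k]!∣n!; k>n⇒nCk≡0; nCn≡1; nC1≡n; nCk≡nC[n∸k])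
open import Data.Nat.Coprimality as Coprimality using (Coprime; coprime-divisor; prime⇒coprime)
open import Data.Nat.DivMod using (m≡m%n+[m/n]*n; m%n<n; m/n*n≡m; m*n/n≡m)
open import Data.Nat.Divisibility
  using (divides; _∣?_; ∣-refl; ∣-trans; ∣-antisym; ∣⇒≤; ∣1⇒≡1; 1∣_; m∣m*n; n∣m*n; ∣m+n∣m⇒∣n; ∣m∣n⇒∣m+n)
open import Data.Nat.GCD using (gcd[m,n]∣m; gcd[m,n]∣n; gcd[m,n]≤n; gcd-greatest)
open import Data.Nat.Induction using (<-rec)
open import Data.Nat.ListAction using (product)
open import Data.Nat.Primality using (euclidsLemma; ¬prime[0]; ¬prime[1]; prime⇒nonZero; prime⇒irreducible)
open import Data.Nat.Primality.Factorisation using (PrimeFactorisation; factorise)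
open import Data.Integer using (ℤ; +_; _+_; _*_; _-_; -_; _^_; 0ℤ; 1ℤ)
open import Data.Integer.Properties using (pos-+; pos-*; abs-*; *-comm; *-assoc; *-cancelˡ-≡; ^-distribˡ-+-*)
open import Data.Integer.Divisibility.Signed
  using (divides; ∣ᵤ⇒∣; ∣⇒∣ᵤ; ∣m⇒∣-m; ∣m⇒∣m*n; ∣n⇒∣m*n; ∣m+n∣n⇒∣m; ∣m∣n⇒∣m-n; *-cancelˡ-∣; *-monoʳ-∣)
  renaming (_∣_ to _∣ᶻ_; ∣-trans to ∣ᶻ-trans; ∣m∣n⇒∣m+n to ∣m∣n⇒∣m+nᶻ; ∣m+n∣m⇒∣n to ∣m+n∣m⇒∣nᶻ)
open import Data.Integer.Tactic.RingSolver using (solve-∀)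
open import Data.List using ([]; _∷_)
open import Data.List.Relation.Unary.All using (All; []; _∷_)
open import Data.Product using (_×_; _,_; proj₂)
open import Data.Product.Function.NonDependent.Propositional using (_×-⇔_)
open import Data.Sum using (_⊎_; inj₁; inj₂)
open import Function.Bundles using (mk⇔; module Equivalence)
open import Function.Construct.Identity using (⇔-id)
open import Function.Related.Propositional using (module EquationalReasoning)
open import Function.Related.TypeIsomorphisms using (¬-cong-⇔)
open import Level using (0ℓ)
open import Relation.Binary.Bundles using (Setoid)
import Relation.Binary.Reasoning.Setoid
open import Relation.Binary.PropositionalEquality
  using (_≡_; refl; sym; trans; cong; cong₂; subst; module ≡-Reasoning)
open import Relation.Nullary using (¬_; contradiction; yes; no)

infix 4 _≈_mod_
record _≈_mod_ (a b d : ℤ) : Set where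
  constructor mod
  field divides-difference : d ∣ᶻ a - b

≡⇒≈ : ∀ {a b d} → a ≡ b → a ≈ b mod d
≡⇒≈ {a} {d = d} refl = mod (divides 0ℤ (a-a≡0*d a d))
  where a-a≡0*d : ∀ a d → a - a ≡ 0ℤ * d
        a-a≡0*d = solve-∀

≈-refl : ∀ {a d} → a ≈ a mod d
≈-refl = ≡⇒≈ refl

≈-sym : ∀ {a b d} → a ≈ b mod d → b ≈ a mod d
≈-sym {a} {b} {d} (mod d∣a-b) = mod (subst (d ∣ᶻ_) (negate a b) (∣m⇒∣-m d∣a-b))
  where negate : ∀ a b → - (a - b) ≡ b - a
        negate = solve-∀

≈-trans : ∀ {a b c d} → a ≈ b mod d → b ≈ c mod d → a ≈ c mod d
≈-trans {a} {b} {c} {d} (mod d∣a-b) (mod d∣b-c) =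
  mod (subst (d ∣ᶻ_) (telescope a b c) (∣m∣n⇒∣m+nᶻ d∣a-b d∣b-c))
  where telescope : ∀ a b c → (a - b) + (b - c) ≡ a - c
        telescope = solve-∀

mod-setoid : ℤ → Setoid 0ℓ 0ℓ
mod-setoid d = record
  { Carrier       = ℤ
  ; _≈_           = λ a b → a ≈ b mod d
  ; isEquivalence = record { refl = ≈-refl ; sym = ≈-sym ; trans = ≈-trans }
  }

module ≈-Reasoning (d : ℤ) = Relation.Binary.Reasoning.Setoid (mod-setoid d)

≈-+ : ∀ {a b c e d} → a ≈ b mod d → c ≈ e mod d → a + c ≈ b + e mod d
≈-+ {a} {b} {c} {e} {d} (mod d∣a-b) (mod d∣c-e) =
  mod (subst (d ∣ᶻ_) (regroup a b c e) (∣m∣n⇒∣m+nᶻ d∣a-b d∣c-e))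
  where regroup : ∀ a b c e → (a - b) + (c - e) ≡ (a + c) - (b + e)
        regroup = solve-∀

≈-* : ∀ {a b c e d} → a ≈ b mod d → c ≈ e mod d → a * c ≈ b * e mod d
≈-* {a} {b} {c} {e} {d} (mod d∣a-b) (mod d∣c-e) =
  mod (subst (d ∣ᶻ_) (regroup a b c e) (∣m∣n⇒∣m+nᶻ (∣m⇒∣m*n c d∣a-b) (∣n⇒∣m*n b d∣c-e)))
  where regroup : ∀ a b c e → (a - b) * c + b * (c - e) ≡ a * c - b * e
        regroup = solve-∀

≈-^ : ∀ {a b d} k → a ≈ b mod d → a ^ k ≈ b ^ k mod d
≈-^ zero    a≈b = ≈-refl
≈-^ (suc k) a≈b = ≈-* a≈b (≈-^ k a≈b)

≈-weaken : ∀ {a b c d} → c ∣ᶻ d → a ≈ b mod d → a ≈ b mod c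
≈-weaken c∣d (mod d∣a-b) = mod (∣ᶻ-trans c∣d d∣a-b)

∣⇒≈0 : ∀ {a d} → d ∣ᶻ a → a ≈ 0ℤ mod d
∣⇒≈0 {a} {d} d∣a = mod (subst (d ∣ᶻ_) (minus-zero a) d∣a)
  where minus-zero : ∀ a → a ≡ a - 0ℤ
        minus-zero = solve-∀

≈0⇒∣ : ∀ {a d} → a ≈ 0ℤ mod d → d ∣ᶻ a
≈0⇒∣ {a} {d} (mod d∣a-0) = subst (d ∣ᶻ_) (minus-zero a) d∣a-0
  where minus-zero : ∀ a → a - 0ℤ ≡ a
        minus-zero = solve-∀

≈-∣ : ∀ {a b d} → a ≈ b mod d → d ∣ᶻ a ⇔ d ∣ᶻ b
≈-∣ a≈b = mk⇔ (λ d∣a → ≈0⇒∣ (≈-trans (≈-sym a≈b) (∣⇒≈0 d∣a)))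
              (λ d∣b → ≈0⇒∣ (≈-trans a≈b (∣⇒≈0 d∣b)))

∑< : ℕ → (ℕ → ℤ) → ℤ
∑< zero    f = 0ℤ
∑< (suc n) f = ∑< n f + f n

syntax ∑< n (λ i → x) = ∑[ i < n ] x

∑-cong : ∀ {f g : ℕ → ℤ} n → (∀ i → f i ≡ g i) → ∑[ i < n ] f i ≡ ∑[ i < n ] g i
∑-cong zero    f≡g = refl
∑-cong (suc n) f≡g = cong₂ _+_ (∑-cong n f≡g) (f≡g n)

∑-cong-mod : ∀ {f g : ℕ → ℤ} {d} n → (∀ i → f i ≈ g i mod d) →
             ∑[ i < n ] f i ≈ ∑[ i < n ] g i mod d
∑-cong-mod zero    f≈g = ≈-refl
∑-cong-mod (suc n) f≈g = ≈-+ (∑-cong-mod n f≈g) (f≈g n)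

∑-+ : ∀ (f g : ℕ → ℤ) n → ∑[ i < n ] (f i + g i) ≡ ∑[ i < n ] f i + ∑[ i < n ] g i
∑-+ f g zero    = refl
∑-+ f g (suc n) = trans (cong (_+ (f n + g n)) (∑-+ f g n)) (interchange (∑< n f) (∑< n g) (f n) (g n))
  where interchange : ∀ a b c e → a + b + (c + e) ≡ a + c + (b + e)
        interchange = solve-∀

∑-*ˡ : ∀ c (f : ℕ → ℤ) n → ∑[ i < n ] (c * f i) ≡ c * ∑[ i < n ] f i
∑-*ˡ c f zero    = sym (times-zero c)
  where times-zero : ∀ c → c * 0ℤ ≡ 0ℤ
        times-zero = solve-∀
∑-*ˡ c f (suc n) = trans (cong (_+ c * f n) (∑-*ˡ c f n)) (sym (distrib c _ _))
  where distrib : ∀ c a b → c * (a + b) ≡ c * a + c * b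
        distrib = solve-∀

∑-const : ∀ c n → ∑[ i < n ] c ≡ + n * c
∑-const c zero    = sym (zero-times c)
  where zero-times : ∀ c → 0ℤ * c ≡ 0ℤ
        zero-times = solve-∀
∑-const c (suc n) = trans (cong (_+ c) (∑-const c n)) (succ-times (+ n) c)
  where succ-times : ∀ n c → n * c + c ≡ (1ℤ + n) * c
        succ-times = solve-∀

∑-shift : ∀ (f : ℕ → ℤ) n → ∑[ i < suc n ] f i ≡ f 0 + ∑[ i < n ] f (suc i)
∑-shift f zero    = comm 0ℤ (f 0)
  where comm : ∀ a b → a + b ≡ b + a
        comm = solve-∀
∑-shift f (suc n) = trans (cong (_+ f (suc n)) (∑-shift f n)) (assoc (f 0) (∑[ i < n ] f (suc i)) (f (suc n)))
  where assoc : ∀ a b c → a + b + c ≡ a + (b + c)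
        assoc = solve-∀

∑-split : ∀ (f : ℕ → ℤ) a b → ∑[ i < a ℕ.+ b ] f i ≡ ∑[ i < a ] f i + ∑[ i < b ] f (a ℕ.+ i)
∑-split f a zero    = trans (cong (λ n → ∑< n f) (ℕₚ.+-identityʳ a)) (sym (plus-zero (∑< a f)))
  where plus-zero : ∀ x → x + 0ℤ ≡ x
        plus-zero = solve-∀
∑-split f a (suc b) = begin
  ∑[ i < a ℕ.+ suc b ] f i                              ≡⟨ cong (λ n → ∑< n f) (ℕₚ.+-suc a b) ⟩
  ∑[ i < a ℕ.+ b ] f i + f (a ℕ.+ b)                    ≡⟨ cong (_+ f (a ℕ.+ b)) (∑-split f a b) ⟩
  ∑[ i < a ] f i + ∑[ i < b ] f (a ℕ.+ i) + f (a ℕ.+ b) ≡⟨ assoc (∑< a f) (∑[ i < b ] f (a ℕ.+ i)) (f (a ℕ.+ b)) ⟩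
  ∑[ i < a ] f i + ∑[ i < suc b ] f (a ℕ.+ i)           ∎
  where open ≡-Reasoning
        assoc : ∀ x y z → x + y + z ≡ x + (y + z)
        assoc = solve-∀

∑-blocks : ∀ (f : ℕ → ℤ) m q →
           ∑[ j < q ℕ.* m ] f j ≡ ∑[ t < q ] ∑[ r < m ] f (t ℕ.* m ℕ.+ r)
∑-blocks f m zero    = refl
∑-blocks f m (suc q) = begin
  ∑[ j < m ℕ.+ q ℕ.* m ] f j                                 ≡⟨ cong (λ n → ∑< n f) (ℕₚ.+-comm m (q ℕ.* m)) ⟩
  ∑[ j < q ℕ.* m ℕ.+ m ] f j                                 ≡⟨ ∑-split f (q ℕ.* m) m ⟩
  ∑[ j < q ℕ.* m ] f j + ∑[ r < m ] f (q ℕ.* m ℕ.+ r)         ≡⟨ cong (_+ ∑[ r < m ] f (q ℕ.* m ℕ.+ r)) (∑-blocks f m q) ⟩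
  ∑[ t < suc q ] ∑[ r < m ] f (t ℕ.* m ℕ.+ r)                ∎
  where open ≡-Reasoning

∑-swap : ∀ (g : ℕ → ℕ → ℤ) m n → ∑[ j < m ] ∑[ i < n ] g i j ≡ ∑[ i < n ] ∑[ j < m ] g i j
∑-swap g zero    n = sym (trans (∑-const 0ℤ n) (times-zero (+ n)))
  where times-zero : ∀ c → c * 0ℤ ≡ 0ℤ
        times-zero = solve-∀
∑-swap g (suc m) n =
  trans (cong (_+ ∑[ i < n ] g i m) (∑-swap g m n)) (sym (∑-+ (λ i → ∑[ j < m ] g i j) (λ i → g i m) n))

∑-telescope : ∀ (f : ℕ → ℤ) m → ∑[ j < m ] (f (suc j) - f j) ≡ f m - f 0
∑-telescope f zero    = sym (minus-self (f 0))
  where minus-self : ∀ x → x - x ≡ 0ℤ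
        minus-self = solve-∀
∑-telescope f (suc m) = trans (cong (_+ (f (suc m) - f m)) (∑-telescope f m)) (collapse (f 0) (f m) (f (suc m)))
  where collapse : ∀ a b c → (b - a) + (c - b) ≡ c - a
        collapse = solve-∀

∑-∣ : ∀ {d} {f : ℕ → ℤ} n → (∀ i → i < n → d ∣ᶻ f i) → d ∣ᶻ ∑[ i < n ] f i
∑-∣ zero    d∣f = divides 0ℤ refl
∑-∣ (suc n) d∣f = ∣m∣n⇒∣m+nᶻ (∑-∣ n (λ i i<n → d∣f i (ℕₚ.m<n⇒m<1+n i<n))) (d∣f n (ℕₚ.n<1+n n))

binomialSum : ℤ → ℕ → ℕ → ℤ
binomialSum x n N = ∑[ i < N ] (+ (n C i) * x ^ i)

-- Pascal's rule, summed over the expansion: multiplying by x + 1 raises n by one.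
binomialSum-suc : ∀ x n N →
  binomialSum x (suc n) (suc N) ≡ x * binomialSum x n N + binomialSum x n (suc N)
binomialSum-suc x n N = begin
  binomialSum x (suc n) (suc N)
    ≡⟨ ∑-shift (λ i → + (suc n C i) * x ^ i) N ⟩
  1ℤ + ∑[ i < N ] (+ (suc n C suc i) * x ^ suc i)
    ≡⟨ cong (λ s → 1ℤ + s) (∑-cong N pascal) ⟩
  1ℤ + ∑[ i < N ] (x * (+ (n C i) * x ^ i) + + (n C suc i) * x ^ suc i)
    ≡⟨ cong (λ s → 1ℤ + s) (∑-+ (λ i → x * (+ (n C i) * x ^ i)) (λ i → + (n C suc i) * x ^ suc i) N) ⟩
  1ℤ + (∑[ i < N ] (x * (+ (n C i) * x ^ i)) + ∑[ i < N ] (+ (n C suc i) * x ^ suc i))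
    ≡⟨ cong (λ s → 1ℤ + (s + ∑[ i < N ] (+ (n C suc i) * x ^ suc i))) (∑-*ˡ x (λ i → + (n C i) * x ^ i) N) ⟩
  1ℤ + (x * binomialSum x n N + ∑[ i < N ] (+ (n C suc i) * x ^ suc i))
    ≡⟨ move-left (x * binomialSum x n N) (∑[ i < N ] (+ (n C suc i) * x ^ suc i)) ⟩
  x * binomialSum x n N + (1ℤ + ∑[ i < N ] (+ (n C suc i) * x ^ suc i))
    ≡⟨ cong (λ s → x * binomialSum x n N + s) (∑-shift (λ i → + (n C i) * x ^ i) N) ⟨
  x * binomialSum x n N + binomialSum x n (suc N) ∎
  where
  open ≡-Reasoning
  pascal : ∀ i → + (suc n C suc i) * x ^ suc i ≡ x * (+ (n C i) * x ^ i) + + (n C suc i) * x ^ suc i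
  pascal i = begin
    + (suc n C suc i) * x ^ suc i                ≡⟨ cong (λ c → + c * x ^ suc i) (nCk+nC[k+1]≡[n+1]C[k+1] n i) ⟨
    + (n C i ℕ.+ n C suc i) * (x * x ^ i)        ≡⟨ cong (_* (x * x ^ i)) (pos-+ (n C i) (n C suc i)) ⟩
    (+ (n C i) + + (n C suc i)) * (x * x ^ i)    ≡⟨ distribute (+ (n C i)) (+ (n C suc i)) x (x ^ i) ⟩
    x * (+ (n C i) * x ^ i) + + (n C suc i) * (x * x ^ i) ∎
    where distribute : ∀ a b x y → (a + b) * (x * y) ≡ x * (a * y) + b * (x * y)
          distribute = solve-∀
  move-left : ∀ u v → 1ℤ + (u + v) ≡ u + (1ℤ + v)
  move-left = solve-∀

binomial : ∀ x n → (x + 1ℤ) ^ n ≡ binomialSum x n (suc n)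
binomial x zero    = refl
binomial x (suc n) = begin
  (x + 1ℤ) * (x + 1ℤ) ^ n                             ≡⟨ cong ((x + 1ℤ) *_) (binomial x n) ⟩
  (x + 1ℤ) * binomialSum x n (suc n)                  ≡⟨ distribute x (binomialSum x n (suc n)) ⟩
  x * binomialSum x n (suc n) + binomialSum x n (suc n)
    ≡⟨ cong (λ s → x * binomialSum x n (suc n) + s) top-vanishes ⟨
  x * binomialSum x n (suc n) + binomialSum x n (suc (suc n)) ≡⟨ binomialSum-suc x n (suc n) ⟨
  binomialSum x (suc n) (suc (suc n))                 ∎
  where
  open ≡-Reasoning
  distribute : ∀ x s → (x + 1ℤ) * s ≡ x * s + s
  distribute = solve-∀
  plus-zero : ∀ s y → s + 0ℤ * y ≡ s
  plus-zero = solve-∀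
  top-vanishes : binomialSum x n (suc (suc n)) ≡ binomialSum x n (suc n)
  top-vanishes = trans (cong (λ c → binomialSum x n (suc n) + + c * x ^ suc n) (k>n⇒nCk≡0 (ℕₚ.n<1+n n)))
                       (plus-zero (binomialSum x n (suc n)) (x ^ suc n))

[1+n]Cn≡1+n : ∀ n → suc n C n ≡ suc n
[1+n]Cn≡1+n n = trans (nCk≡nC[n∸k] (ℕₚ.n≤1+n n)) (trans (cong (suc n C_) (ℕₚ.m+n∸n≡m 1 n)) (nC1≡n (suc n)))

prime∤1 : ∀ {p} → Prime p → ¬ p ∣ 1
prime∤1 p-prime p∣1 = ¬prime[1] (subst Prime (∣1⇒≡1 p∣1) p-prime)

prime∤! : ∀ {p} m → Prime p → m < p → ¬ p ∣ m !
prime∤! zero    p-prime _   = prime∤1 p-prime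
prime∤! (suc m) p-prime m<p p∣m! with euclidsLemma (suc m) (m !) p-prime p∣m!
... | inj₁ p∣1+m = ℕₚ.<⇒≱ m<p (∣⇒≤ p∣1+m)
... | inj₂ p∣m!  = prime∤! m p-prime (ℕₚ.<-trans (ℕₚ.n<1+n m) m<p) p∣m!

binomial·factorials : ∀ {n k} → k ≤ n → (n C k) ℕ.* (k ! ℕ.* (n ∸ k) !) ≡ n !
binomial·factorials {n} {k} k≤n = begin
  (n C k) ℕ.* (k ! ℕ.* (n ∸ k) !)                    ≡⟨ cong (ℕ._* (k ! ℕ.* (n ∸ k) !)) (nCk≡n!/k![n-k]! k≤n) ⟩
  n ! / (k ! ℕ.* (n ∸ k) !) ℕ.* (k ! ℕ.* (n ∸ k) !)  ≡⟨ m/n*n≡m (k![n∸k]!∣n! k≤n) ⟩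
  n !                                                ∎
  where open ≡-Reasoning
        instance _ = k ℕₚ.!* (n ∸ k) !≢0

n∣n! : ∀ n → .{{NonZero n}} → n ∣ n !
n∣n! (suc n) = m∣m*n (n !)

-- p divides the inner binomial coefficients (p choose k), 0 < k < p:
-- it divides p! = (p choose k) · k! · (p - k)! but neither factorial.
prime∣binomial : ∀ {p k} → Prime p → 0 < k → k < p → p ∣ p C k
prime∣binomial {p} {k} p-prime 0<k k<p
  with euclidsLemma (p C k) (k ! ℕ.* (p ∸ k) !) p-prime
         (subst (p ∣_) (sym (binomial·factorials (ℕₚ.<⇒≤ k<p))) (n∣n! p {{prime⇒nonZero p-prime}}))
... | inj₁ p∣C = p∣C
... | inj₂ p∣k!·[p-k]! with euclidsLemma (k !) ((p ∸ k) !) p-prime p∣k!·[p-k]!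
...   | inj₁ p∣k!     = contradiction p∣k! (prime∤! k p-prime k<p)
...   | inj₂ p∣[p-k]! = contradiction p∣[p-k]! (prime∤! (p ∸ k) p-prime (ℕₚ.∸-monoʳ-< 0<k (ℕₚ.<⇒≤ k<p)))

-- Fermat's little theorem: jᵖ ≡ j (mod p), by induction on j, since
-- (j + 1)ᵖ ≡ jᵖ + 1 (mod p) by the binomial theorem and prime∣binomial.
fermat : ∀ {p} → Prime p → ∀ j → (+ j) ^ p ≈ + j mod + p
fermat {zero}  p-prime = contradiction p-prime ¬prime[0]
fermat {suc q} p-prime zero    = ≡⇒≈ (zero-times ((+ 0) ^ q))
  where zero-times : ∀ y → 0ℤ * y ≡ 0ℤ
        zero-times = solve-∀
fermat {suc q} p-prime (suc j) = begin
  (+ suc j) ^ p                                           ≡⟨ cong (_^ p) (comm 1ℤ (+ j)) ⟩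
  (+ j + 1ℤ) ^ p                                          ≡⟨ binomial (+ j) p ⟩
  binomialSum (+ j) p p + + (p C p) * (+ j) ^ p
    ≡⟨ cong₂ (λ s c → s + + c * (+ j) ^ p) (∑-shift (λ i → + (p C i) * (+ j) ^ i) q) (nCn≡1 p) ⟩
  1ℤ + ∑[ i < q ] (+ (p C suc i) * (+ j) ^ suc i) + + 1 * (+ j) ^ p
    ≈⟨ ≈-+ (≈-+ (≈-refl {1ℤ}) inner-terms-vanish) (≈-* (≈-refl {+ 1}) (fermat p-prime j)) ⟩
  1ℤ + 0ℤ + + 1 * + j                                     ≡⟨ simplify (+ j) ⟩
  + suc j                                                 ∎
  where
  p = suc q
  open ≈-Reasoning (+ p)
  comm : ∀ a b → a + b ≡ b + a
  comm = solve-∀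
  simplify : ∀ x → 1ℤ + 0ℤ + + 1 * x ≡ 1ℤ + x
  simplify = solve-∀
  inner-terms-vanish : ∑[ i < q ] (+ (p C suc i) * (+ j) ^ suc i) ≈ 0ℤ mod + p
  inner-terms-vanish = ∣⇒≈0 (∑-∣ q (λ i i<q →
    ∣m⇒∣m*n ((+ j) ^ suc i) (∣ᵤ⇒∣ {+ p} {+ (p C suc i)} (prime∣binomial p-prime (s≤s z≤n) (s≤s i<q)))))

S : ℕ → ℕ → ℤ
S e m = ∑[ j < m ] ((+ j) ^ e)

SelfDivisor : ℕ → ℕ → Set
SelfDivisor e m = + m ∣ᶻ S e m

pos-^ : ∀ a k → + (a ℕ.^ k) ≡ (+ a) ^ k
pos-^ a zero    = refl
pos-^ a (suc k) = trans (pos-* a (a ℕ.^ k)) (cong (+ a *_) (pos-^ a k))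

-- For a positive exponent the term 0ᵉ vanishes, so powSum (from Defs) is S.
powSum≡S : ∀ e M → + powSum (suc e) M ≡ S (suc e) (suc M)
powSum≡S e zero    = sym (zero-term ((+ 0) ^ e))
  where zero-term : ∀ y → 0ℤ + 0ℤ * y ≡ 0ℤ
        zero-term = solve-∀
powSum≡S e (suc M) =
  trans (pos-+ (powSum (suc e) M) (suc M ℕ.^ suc e)) (cong₂ _+_ (powSum≡S e M) (pos-^ (suc M) (suc e)))

pos-block : ∀ t m r → + (t ℕ.* m ℕ.+ r) ≡ + r + + m * + t
pos-block t m r = trans (pos-+ (t ℕ.* m) r) (trans (cong (_+ + r) (pos-* t m)) (rearrange (+ t) (+ m) (+ r)))
  where rearrange : ∀ t m r → t * m + r ≡ r + m * t
        rearrange = solve-∀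

block-residue : ∀ t m r → + (t ℕ.* m ℕ.+ r) ≈ + r mod + m
block-residue t m r = mod (divides (+ t) (trans (cong (_- + r) (pos-block t m r)) (cancel (+ r) (+ m) (+ t))))
  where cancel : ∀ r m t → r + m * t - r ≡ t * m
        cancel = solve-∀

-- S e (q·m) ≡ q · S e m (mod m): the residues mod m repeat in each of the q blocks.
S-blocks : ∀ e m q → S e (q ℕ.* m) ≈ + q * S e m mod + m
S-blocks e m q = begin
  S e (q ℕ.* m)                                       ≡⟨ ∑-blocks (λ j → (+ j) ^ e) m q ⟩
  ∑[ t < q ] ∑[ r < m ] ((+ (t ℕ.* m ℕ.+ r)) ^ e)
    ≈⟨ ∑-cong-mod q (λ t → ∑-cong-mod m (λ r → ≈-^ e (block-residue t m r))) ⟩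
  ∑[ t < q ] S e m                                    ≡⟨ ∑-const (S e m) q ⟩
  + q * S e m                                         ∎
  where open ≈-Reasoning (+ m)

∑-naturals : ∀ n → + 2 * ∑[ t < n ] (+ t) ≡ + n * (+ n - 1ℤ)
∑-naturals zero    = refl
∑-naturals (suc n) = begin
  + 2 * (∑[ t < n ] (+ t) + + n)        ≡⟨ distrib (∑[ t < n ] (+ t)) (+ n) ⟩
  + 2 * ∑[ t < n ] (+ t) + + 2 * + n    ≡⟨ cong (_+ + 2 * + n) (∑-naturals n) ⟩
  + n * (+ n - 1ℤ) + + 2 * + n          ≡⟨ step (+ n) ⟩
  (1ℤ + + n) * (1ℤ + + n - 1ℤ)          ∎
  where
  open ≡-Reasoning
  distrib : ∀ s n → + 2 * (s + n) ≡ + 2 * s + + 2 * n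
  distrib = solve-∀
  step : ∀ n → n * (n - 1ℤ) + + 2 * n ≡ (1ℤ + n) * (1ℤ + n - 1ℤ)
  step = solve-∀

-- For odd p, (p - 1)/2 is an integer, so p divides 0 + 1 + ⋯ + (p - 1).
odd∣∑naturals : ∀ {p} → Odd p → + p ∣ᶻ ∑[ t < p ] (+ t)
odd∣∑naturals {p} (h , refl) = divides (+ h) (*-cancelˡ-≡ (+ 2) (∑[ t < p ] (+ t)) (+ h * + p) (begin
  + 2 * ∑[ t < p ] (+ t)                    ≡⟨ ∑-naturals p ⟩
  + p * (+ p - 1ℤ)                          ≡⟨ cong (λ n → n * (n - 1ℤ)) p≡1+2h ⟩
  (1ℤ + + 2 * + h) * (1ℤ + + 2 * + h - 1ℤ)  ≡⟨ halve (+ h) ⟩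
  + 2 * (+ h * (1ℤ + + 2 * + h))            ≡⟨ cong (λ n → + 2 * (+ h * n)) p≡1+2h ⟨
  + 2 * (+ h * + p)                         ∎))
  where
  open ≡-Reasoning
  p≡1+2h : + p ≡ 1ℤ + + 2 * + h
  p≡1+2h = trans (pos-+ 1 (2 ℕ.* h)) (cong (λ n → 1ℤ + n) (pos-* 2 h))
  halve : ∀ h → (1ℤ + + 2 * h) * (1ℤ + + 2 * h - 1ℤ) ≡ + 2 * (h * (1ℤ + + 2 * h))
  halve = solve-∀

-- deriv a k = k · aᵏ⁻¹, the derivative of xᵏ at a, built by the product rule.
deriv : ℤ → ℕ → ℤ
deriv a zero    = 0ℤ
deriv a (suc k) = a * deriv a k + a ^ k

taylor : ∀ a x k → (a + x) ^ k ≈ a ^ k + x * deriv a k mod x * x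
taylor a x zero    = ≡⇒≈ (sym (plus-zero x))
  where plus-zero : ∀ x → 1ℤ + x * 0ℤ ≡ 1ℤ
        plus-zero = solve-∀
taylor a x (suc k) = begin
  (a + x) * (a + x) ^ k                             ≈⟨ ≈-* (≈-refl {a + x}) (taylor a x k) ⟩
  (a + x) * (a ^ k + x * deriv a k)                 ≡⟨ expand a x (a ^ k) (deriv a k) ⟩
  a * a ^ k + x * deriv a (suc k) + x * x * deriv a k
    ≈⟨ ≈-+ (≈-refl {a * a ^ k + x * deriv a (suc k)}) (∣⇒≈0 (divides (deriv a k) (comm (x * x) (deriv a k)))) ⟩
  a * a ^ k + x * deriv a (suc k) + 0ℤ              ≡⟨ plus-zero (a * a ^ k + x * deriv a (suc k)) ⟩
  a * a ^ k + x * deriv a (suc k)                   ∎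
  where
  open ≈-Reasoning (x * x)
  expand : ∀ a x A D → (a + x) * (A + x * D) ≡ a * A + x * (a * D + A) + x * x * D
  expand = solve-∀
  comm : ∀ a b → a * b ≡ b * a
  comm = solve-∀
  plus-zero : ∀ y → y + 0ℤ ≡ y
  plus-zero = solve-∀

∣-square : ∀ {p m} x → p ∣ m → + (p ℕ.* m) ∣ᶻ (+ m * x) * (+ m * x)
∣-square {p} {m} x (divides u m≡u·p) = divides (x * x * + u) (begin
  (+ m * x) * (+ m * x)              ≡⟨ cong (λ n → (n * x) * (+ m * x)) (trans (cong +_ m≡u·p) (pos-* u p)) ⟩
  (+ u * + p * x) * (+ m * x)        ≡⟨ regroup (+ u) (+ p) x (+ m) ⟩
  x * x * + u * (+ p * + m)          ≡⟨ cong (x * x * + u *_) (pos-* p m) ⟨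
  x * x * + u * + (p ℕ.* m)          ∎)
  where open ≡-Reasoning
        regroup : ∀ u p x m → (u * p * x) * (m * x) ≡ x * x * u * (p * m)
        regroup = solve-∀

-- Expanding (tm + r)ᵉ to first order in tm, the linear terms sum to a multiple of
-- m · (0 + 1 + ⋯ + (p - 1)), which p·m divides because p is odd.
S-lift : ∀ e {p m} → Odd p → p ∣ m → S e (p ℕ.* m) ≈ + p * S e m mod + (p ℕ.* m)
S-lift e {p} {m} p-odd p∣m = begin
  S e (p ℕ.* m)                                                  ≡⟨ ∑-blocks (λ j → (+ j) ^ e) m p ⟩
  ∑[ t < p ] ∑[ r < m ] ((+ (t ℕ.* m ℕ.+ r)) ^ e)
    ≡⟨ ∑-cong p (λ t → ∑-cong m (λ r → cong (_^ e) (pos-block t m r))) ⟩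
  ∑[ t < p ] ∑[ r < m ] ((+ r + + m * + t) ^ e)
    ≈⟨ ∑-cong-mod p (λ t → ∑-cong-mod m (λ r → ≈-weaken (∣-square (+ t) p∣m) (taylor (+ r) (+ m * + t) e))) ⟩
  ∑[ t < p ] ∑[ r < m ] ((+ r) ^ e + + m * + t * deriv (+ r) e)
    ≡⟨ ∑-cong p (λ t → trans (∑-+ (λ r → (+ r) ^ e) (λ r → + m * + t * deriv (+ r) e) m)
                              (cong (λ s → S e m + s) (∑-*ˡ (+ m * + t) (λ r → deriv (+ r) e) m))) ⟩
  ∑[ t < p ] (S e m + + m * + t * D)
    ≡⟨ ∑-+ (λ _ → S e m) (λ t → + m * + t * D) p ⟩
  ∑[ t < p ] S e m + ∑[ t < p ] (+ m * + t * D)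
    ≡⟨ cong₂ _+_ (∑-const (S e m) p) (trans (∑-cong p (λ t → rearrange (+ m) (+ t) D)) (∑-*ˡ (+ m * D) +_ p)) ⟩
  + p * S e m + + m * D * ∑[ t < p ] (+ t)
    ≈⟨ ≈-+ (≈-refl {+ p * S e m}) (∣⇒≈0 pm∣mD∑t) ⟩
  + p * S e m + 0ℤ                                               ≡⟨ plus-zero (+ p * S e m) ⟩
  + p * S e m                                                    ∎
  where
  open ≈-Reasoning (+ (p ℕ.* m))
  D : ℤ
  D = ∑[ r < m ] deriv (+ r) e
  rearrange : ∀ m t D → m * t * D ≡ m * D * t
  rearrange = solve-∀
  plus-zero : ∀ y → y + 0ℤ ≡ y
  plus-zero = solve-∀
  pm : + (p ℕ.* m) ≡ + p * + m
  pm = pos-* p m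
  pm∣mD∑t : + (p ℕ.* m) ∣ᶻ + m * D * ∑[ t < p ] (+ t)
  pm∣mD∑t with odd∣∑naturals p-odd
  ... | divides c ∑t≡c·p = divides (c * D) (trans (cong (+ m * D *_) ∑t≡c·p)
                                             (trans (regroup (+ m) D c (+ p)) (cong (c * D *_) (sym pm))))
    where regroup : ∀ m D c p → m * D * (c * p) ≡ c * D * (p * m)
          regroup = solve-∀

-- Telescope (j + 1)^(k+1) - j^(k+1)
-- over j < m and expand each difference by the binomial theorem.
S-recurrence : ∀ k m → (+ m) ^ suc k ≡ ∑[ i < suc k ] (+ (suc k C i) * S i m)
S-recurrence k m = begin
  (+ m) ^ suc k                                                ≡⟨ minus-zero ((+ m) ^ suc k) ((+ 0) ^ k) ⟩
  (+ m) ^ suc k - (+ 0) ^ suc k                                ≡⟨ ∑-telescope (λ j → (+ j) ^ suc k) m ⟨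
  ∑[ j < m ] ((+ suc j) ^ suc k - (+ j) ^ suc k)                ≡⟨ ∑-cong m increment ⟩
  ∑[ j < m ] ∑[ i < suc k ] (+ (suc k C i) * (+ j) ^ i)         ≡⟨ ∑-swap (λ i j → + (suc k C i) * (+ j) ^ i) m (suc k) ⟩
  ∑[ i < suc k ] ∑[ j < m ] (+ (suc k C i) * (+ j) ^ i)         ≡⟨ ∑-cong (suc k) (λ i → ∑-*ˡ (+ (suc k C i)) (λ j → (+ j) ^ i) m) ⟩
  ∑[ i < suc k ] (+ (suc k C i) * S i m)                        ∎
  where
  open ≡-Reasoning
  minus-zero : ∀ x y → x ≡ x - 0ℤ * y
  minus-zero = solve-∀
  increment : ∀ j → (+ suc j) ^ suc k - (+ j) ^ suc k ≡ binomialSum (+ j) (suc k) (suc k)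
  increment j = begin
    (+ suc j) ^ suc k - (+ j) ^ suc k                          ≡⟨ cong (λ x → x ^ suc k - (+ j) ^ suc k) (comm 1ℤ (+ j)) ⟩
    (+ j + 1ℤ) ^ suc k - (+ j) ^ suc k                         ≡⟨ cong (_- (+ j) ^ suc k) (binomial (+ j) (suc k)) ⟩
    binomialSum (+ j) (suc k) (suc k) + + (suc k C suc k) * (+ j) ^ suc k - (+ j) ^ suc k
      ≡⟨ cong (λ c → binomialSum (+ j) (suc k) (suc k) + + c * (+ j) ^ suc k - (+ j) ^ suc k) (nCn≡1 (suc k)) ⟩
    binomialSum (+ j) (suc k) (suc k) + + 1 * (+ j) ^ suc k - (+ j) ^ suc k ≡⟨ cancel _ _ ⟩
    binomialSum (+ j) (suc k) (suc k)                          ∎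
    where comm : ∀ a b → a + b ≡ b + a
          comm = solve-∀
          cancel : ∀ s y → s + + 1 * y - y ≡ s
          cancel = solve-∀

coprime-divisorᶻ : ∀ {m n x} → Coprime m n → + m ∣ᶻ + n * x → + m ∣ᶻ x
coprime-divisorᶻ {m} {n} {x} m⊥n m∣nx =
  ∣ᵤ⇒∣ (coprime-divisor m⊥n (subst (m ∣_) (abs-* (+ n) x) (∣⇒∣ᵤ m∣nx)))

∣*∣ : ∀ {d a b} → d ∣ᶻ a → d ∣ᶻ b → d * d ∣ᶻ a * b
∣*∣ {d} (divides u refl) (divides v refl) = divides (u * v) (regroup u v d)
  where regroup : ∀ u v d → (u * d) * (v * d) ≡ (u * v) * (d * d)
        regroup = solve-∀

module PowerSumsModPrime (r : ℕ) (p-prime : Prime (suc (suc r))) where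

  q : ℕ
  q = suc r

  p : ℕ
  p = suc q

  -- Fermat makes exponents periodic with period p - 1.
  S-period : ∀ e → S (e ℕ.+ p) p ≈ S (suc e) p mod + p
  S-period e = ∑-cong-mod p term
    where
    term : ∀ j → (+ j) ^ (e ℕ.+ p) ≈ (+ j) ^ suc e mod + p
    term j = begin
      (+ j) ^ (e ℕ.+ p)      ≡⟨ ^-distribˡ-+-* (+ j) e p ⟩
      (+ j) ^ e * (+ j) ^ p  ≈⟨ ≈-* (≈-refl {(+ j) ^ e}) (fermat p-prime j) ⟩
      (+ j) ^ e * + j        ≡⟨ comm ((+ j) ^ e) (+ j) ⟩
      (+ j) ^ suc e          ∎
      where open ≈-Reasoning (+ p)
            comm : ∀ a b → a * b ≡ b * a
            comm = solve-∀

  S-periodic : ∀ s t → S (suc s ℕ.+ t ℕ.* q) p ≈ S (suc s) p mod + p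
  S-periodic s zero    = ≡⇒≈ (cong (λ e → S e p) (ℕₚ.+-identityʳ (suc s)))
  S-periodic s (suc t) = begin
    S (suc s ℕ.+ suc t ℕ.* q) p     ≡⟨ cong (λ e → S e p) (shift s t q) ⟩
    S ((s ℕ.+ t ℕ.* q) ℕ.+ p) p     ≈⟨ S-period (s ℕ.+ t ℕ.* q) ⟩
    S (suc s ℕ.+ t ℕ.* q) p         ≈⟨ S-periodic s t ⟩
    S (suc s) p                     ∎
    where open ≈-Reasoning (+ p)
          shift : ∀ s t q → suc s ℕ.+ (q ℕ.+ t ℕ.* q) ≡ (s ℕ.+ t ℕ.* q) ℕ.+ suc q
          shift = ℕ-Solver.solve-∀

  -- p divides S k p for every k < p - 1, by strong induction through S-recurrence:
  -- (k+1) · S k p ≡ p^(k+1) - ∑[ i < k ] (k+1 choose i) S i p ≡ 0 (mod p).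
  S-low : ∀ k → suc k < p → SelfDivisor k p
  S-low = <-rec (λ k → suc k < p → SelfDivisor k p) step
    where
    step : ∀ k → (∀ {i} → i < k → suc i < p → SelfDivisor i p) → suc k < p → SelfDivisor k p
    step k below 1+k<p = coprime-divisorᶻ (prime⇒coprime p-prime 1+k<p) p∣[1+k]S
      where
      lower : + p ∣ᶻ ∑[ i < k ] (+ (suc k C i) * S i p)
      lower = ∑-∣ k (λ i i<k → ∣n⇒∣m*n (+ (suc k C i)) (below i<k (ℕₚ.<-trans (s≤s i<k) 1+k<p)))
      p∣[1+k]S : + p ∣ᶻ + suc k * S k p
      p∣[1+k]S = subst (λ c → + p ∣ᶻ + c * S k p) ([1+n]Cn≡1+n k)
        (∣m+n∣m⇒∣nᶻ (subst (+ p ∣ᶻ_) (S-recurrence k p) (divides ((+ p) ^ k) (comm (+ p) ((+ p) ^ k)))) lower)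
        where comm : ∀ a b → a * b ≡ b * a
              comm = solve-∀

  -- p does not divide S (p - 1) p: by S-recurrence at k = p - 1, modulo p²,
  -- 0 ≡ pᵖ ≡ p · (1 + S (p - 1) p), since the middle terms are products of two
  -- multiples of p; hence S (p - 1) p ≡ -1 (mod p).
  S-top : ¬ SelfDivisor q p
  S-top p∣S = contradiction (∣1⇒≡1 (∣⇒∣ᵤ {+ p} {1ℤ} (∣m+n∣n⇒∣m p∣1+S p∣S))) λ ()
    where
    M : ℤ
    M = ∑[ i < r ] (+ (p C suc i) * S (suc i) p)
    expansion : (+ p) ^ p ≡ + 1 * (+ p * 1ℤ) + M + + p * S q p
    expansion = begin
      (+ p) ^ p                                             ≡⟨ S-recurrence q p ⟩
      ∑[ i < q ] (+ (p C i) * S i p) + + (p C q) * S q p    ≡⟨ cong₂ (λ s c → s + + c * S q p) (∑-shift (λ i → + (p C i) * S i p) r) ([1+n]Cn≡1+n q) ⟩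
      + 1 * S 0 p + M + + p * S q p                         ≡⟨ cong (λ s → + 1 * s + M + + p * S q p) (∑-const 1ℤ p) ⟩
      + 1 * (+ p * 1ℤ) + M + + p * S q p                    ∎
      where open ≡-Reasoning
    p²∣M : + p * + p ∣ᶻ M
    p²∣M = ∑-∣ r (λ i i<r → ∣*∣ (∣ᵤ⇒∣ {+ p} {+ (p C suc i)} (prime∣binomial p-prime (s≤s z≤n) (s≤s (s≤s (ℕₚ.<⇒≤ i<r)))))
                                   (S-low (suc i) (s≤s (s≤s i<r))))
    p²∣pᵖ : + p * + p ∣ᶻ (+ p) ^ p
    p²∣pᵖ = divides ((+ p) ^ r) (comm (+ p) ((+ p) ^ r))
      where comm : ∀ a b → a * (a * b) ≡ b * (a * a)
            comm = solve-∀
    p∣1+S : + p ∣ᶻ 1ℤ + S q p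
    p∣1+S = *-cancelˡ-∣ (+ p) (subst (+ p * + p ∣ᶻ_) (trans (cong (_- M) expansion) (factor (+ p) M (S q p)))
                                     (∣m∣n⇒∣m-n p²∣pᵖ p²∣M))
      where factor : ∀ p M s → + 1 * (p * 1ℤ) + M + p * s - M ≡ p * (1ℤ + s)
            factor = solve-∀

  criterion-residue : ∀ s → s < q → SelfDivisor (suc s) p ⇔ (¬ q ∣ suc s)
  criterion-residue s s<q with ℕₚ.m≤n⇒m<n∨m≡n s<q
  ... | inj₁ 1+s<q = mk⇔ (λ _ q∣1+s → ℕₚ.<⇒≱ 1+s<q (∣⇒≤ q∣1+s)) (λ _ → S-low (suc s) (s≤s 1+s<q))
  ... | inj₂ refl  = mk⇔ (λ p∣S → contradiction p∣S S-top) (λ q∤q → contradiction ∣-refl q∤q)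

  -- Local criterion: for e > 0, p ∣ S e p exactly when (p - 1) ∤ e.
  -- Reduce e to its residue 1 ≤ s ≤ p - 1 modulo p - 1 and apply criterion-residue.
  localCriterion : ∀ e → SelfDivisor (suc e) p ⇔ (¬ q ∣ suc e)
  localCriterion e = begin
    SelfDivisor (suc e) p    ∼⟨ ≈-∣ (subst (λ x → S x p ≈ S (suc s) p mod + p) (sym 1+e≡1+s+tq) (S-periodic s t)) ⟩
    SelfDivisor (suc s) p    ∼⟨ criterion-residue s (m%n<n e q) ⟩
    (¬ q ∣ suc s)            ∼⟨ ¬-cong-⇔ q∣shift ⟩
    (¬ q ∣ suc e)            ∎
    where
    open EquationalReasoning
    s t : ℕ
    s = e % q
    t = e / q
    1+e≡1+s+tq : suc e ≡ suc s ℕ.+ t ℕ.* q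
    1+e≡1+s+tq = cong suc (m≡m%n+[m/n]*n e q)
    q∣shift : q ∣ suc s ⇔ q ∣ suc e
    q∣shift = mk⇔ (λ q∣1+s → subst (q ∣_) (sym 1+e≡1+s+tq) (∣m∣n⇒∣m+n q∣1+s (n∣m*n t)))
                  (λ q∣1+e → ∣m+n∣m⇒∣n (subst (q ∣_) (trans 1+e≡1+s+tq (ℕₚ.+-comm (suc s) (t ℕ.* q))) q∣1+e) (n∣m*n t))

primeCriterion : ∀ {p} e → Prime p → SelfDivisor (suc e) p ⇔ (¬ p ∸ 1 ∣ suc e)
primeCriterion {zero}        e p-prime = contradiction p-prime ¬prime[0]
primeCriterion {suc zero}    e p-prime = contradiction p-prime ¬prime[1]
primeCriterion {suc (suc r)} e p-prime = PowerSumsModPrime.localCriterion r p-prime e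

odd-or-even : ∀ m → Odd m ⊎ 2 ∣ m
odd-or-even zero = inj₂ (divides 0 refl)
odd-or-even (suc m) with odd-or-even m
... | inj₁ (k , refl)      = inj₂ (divides (suc k) (double k))
  where double : ∀ k → suc (suc (2 ℕ.* k)) ≡ suc k ℕ.* 2
        double = ℕ-Solver.solve-∀
... | inj₂ (divides h refl) = inj₁ (h , cong suc (ℕₚ.*-comm h 2))

odd-divisor : ∀ {m n} → Odd n → m ∣ n → Odd m
odd-divisor {m} (k , refl) m∣n with odd-or-even m
... | inj₁ m-odd = m-odd
... | inj₂ 2∣m   = contradiction (∣1⇒≡1 2∣1) λ ()
  where 2∣1 : 2 ∣ 1
        2∣1 = ∣m+n∣m⇒∣n (subst (2 ∣_) (ℕₚ.+-comm 1 (2 ℕ.* k)) (∣-trans 2∣m m∣n)) (divides k (ℕₚ.*-comm 2 k))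

prime⊥ : ∀ {p u} → Prime p → ¬ p ∣ u → Coprime p u
prime⊥ p-prime p∤u (i∣p , i∣u) with prime⇒irreducible p-prime i∣p
... | inj₁ i≡1 = i≡1
... | inj₂ refl = contradiction i∣u p∤u

coprime-∣ᶻ : ∀ {m n x} → Coprime m n → + m ∣ᶻ x → + n ∣ᶻ x → + (m ℕ.* n) ∣ᶻ x
coprime-∣ᶻ {m} {n} m⊥n m∣yn (divides y refl)
  with coprime-divisorᶻ m⊥n (subst (+ m ∣ᶻ_) (*-comm y (+ n)) m∣yn)
... | divides z refl = divides z (trans (*-assoc z (+ m) (+ n)) (cong (z *_) (sym (pos-* m n))))

primeDivisors-* : ∀ {p u} (P : ℕ → Set) → Prime p →
  (P p × (∀ ℓ → Prime ℓ → ℓ ∣ u → P ℓ)) ⇔ (∀ ℓ → Prime ℓ → ℓ ∣ p ℕ.* u → P ℓ)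
primeDivisors-* {p} {u} P p-prime = mk⇔ to from
  where
  to : P p × (∀ ℓ → Prime ℓ → ℓ ∣ u → P ℓ) → ∀ ℓ → Prime ℓ → ℓ ∣ p ℕ.* u → P ℓ
  to (Pp , Pu) ℓ ℓ-prime ℓ∣pu with euclidsLemma p u ℓ-prime ℓ∣pu
  ... | inj₂ ℓ∣u = Pu ℓ ℓ-prime ℓ∣u
  ... | inj₁ ℓ∣p with prime⇒irreducible p-prime ℓ∣p
  ...   | inj₁ refl = contradiction ℓ-prime ¬prime[1]
  ...   | inj₂ refl = Pp
  from : (∀ ℓ → Prime ℓ → ℓ ∣ p ℕ.* u → P ℓ) → P p × (∀ ℓ → Prime ℓ → ℓ ∣ u → P ℓ)
  from P∣pu = P∣pu p p-prime (m∣m*n u) , λ ℓ ℓ-prime ℓ∣u → P∣pu ℓ ℓ-prime (∣-trans ℓ∣u (n∣m*n p))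

selfDivisor-repeated : ∀ e {p u} → Odd p → p ∣ u → SelfDivisor e (p ℕ.* u) ⇔ SelfDivisor e u
selfDivisor-repeated e {p} {u} p-odd@(_ , refl) p∣u = begin
  SelfDivisor e (p ℕ.* u)           ∼⟨ ≈-∣ (S-lift e p-odd p∣u) ⟩
  (+ (p ℕ.* u) ∣ᶻ + p * S e u)      ∼⟨ mk⇔ (λ pu∣pS → *-cancelˡ-∣ (+ p) (subst (_∣ᶻ + p * S e u) (pos-* p u) pu∣pS))
                                           (λ u∣S → subst (_∣ᶻ + p * S e u) (sym (pos-* p u)) (*-monoʳ-∣ (+ p) u∣S)) ⟩
  SelfDivisor e u                   ∎
  where open EquationalReasoning

-- Splitting off a prime p ∤ u: pu ∣ S e (pu) ⇔ p ∣ S e p and u ∣ S e u,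
-- because S e (pu) ≡ u · S e p (mod p) and S e (pu) ≡ p · S e u (mod u).
selfDivisor-coprime : ∀ e {p u} → Prime p → ¬ p ∣ u →
  SelfDivisor e (p ℕ.* u) ⇔ (SelfDivisor e p × SelfDivisor e u)
selfDivisor-coprime e {p} {u} p-prime p∤u = mk⇔ split combine
  where
  p⊥u : Coprime p u
  p⊥u = prime⊥ p-prime p∤u
  mod-p : S e (p ℕ.* u) ≈ + u * S e p mod + p
  mod-p = subst (λ n → S e n ≈ + u * S e p mod + p) (ℕₚ.*-comm u p) (S-blocks e p u)
  mod-u : S e (p ℕ.* u) ≈ + p * S e u mod + u
  mod-u = S-blocks e u p
  split : SelfDivisor e (p ℕ.* u) → SelfDivisor e p × SelfDivisor e u
  split pu∣S = coprime-divisorᶻ p⊥u (Equivalence.to (≈-∣ mod-p) (∣ᶻ-trans (∣ᵤ⇒∣ (m∣m*n u)) pu∣S))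
             , coprime-divisorᶻ (Coprimality.sym p⊥u) (Equivalence.to (≈-∣ mod-u) (∣ᶻ-trans (∣ᵤ⇒∣ (n∣m*n p)) pu∣S))
  combine : SelfDivisor e p × SelfDivisor e u → SelfDivisor e (p ℕ.* u)
  combine (p∣S , u∣S) = coprime-∣ᶻ p⊥u (Equivalence.from (≈-∣ mod-p) (∣n⇒∣m*n (+ u) p∣S))
                                       (Equivalence.from (≈-∣ mod-u) (∣n⇒∣m*n (+ p) u∣S))

localGlobal : ∀ e {n} → Odd n → SelfDivisor e n ⇔ (∀ p → Prime p → p ∣ n → SelfDivisor e p)
localGlobal e {n} n-odd@(_ , refl) = subst Goal (sym isFactorisation) (go factors factorsPrime (subst Odd isFactorisation n-odd))
  where
  open PrimeFactorisation (factorise n)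
  Goal : ℕ → Set
  Goal m = SelfDivisor e m ⇔ (∀ p → Prime p → p ∣ m → SelfDivisor e p)
  go : ∀ ps → All Prime ps → Odd (product ps) → Goal (product ps)
  go [] [] _ = mk⇔ (λ _ p p-prime p∣1 → contradiction p∣1 (prime∤1 p-prime))
                   (λ _ → ∣ᵤ⇒∣ (1∣ _))
  go (p ∷ ps) (p-prime ∷ ps-prime) pu-odd with p ∣? product ps
  ... | yes p∣u = begin
    SelfDivisor e (p ℕ.* product ps)                        ∼⟨ selfDivisor-repeated e (odd-divisor pu-odd (m∣m*n (product ps))) p∣u ⟩
    SelfDivisor e (product ps)                              ∼⟨ go ps ps-prime (odd-divisor pu-odd (n∣m*n p)) ⟩
    (∀ ℓ → Prime ℓ → ℓ ∣ product ps → SelfDivisor e ℓ)      ∼⟨ mk⇔ (λ P∣u → P∣u p p-prime p∣u , P∣u) proj₂ ⟩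
    (SelfDivisor e p × (∀ ℓ → Prime ℓ → ℓ ∣ product ps → SelfDivisor e ℓ))
                                                            ∼⟨ primeDivisors-* (SelfDivisor e) p-prime ⟩
    (∀ ℓ → Prime ℓ → ℓ ∣ p ℕ.* product ps → SelfDivisor e ℓ) ∎
    where open EquationalReasoning
  ... | no p∤u = begin
    SelfDivisor e (p ℕ.* product ps)                        ∼⟨ selfDivisor-coprime e p-prime p∤u ⟩
    (SelfDivisor e p × SelfDivisor e (product ps))          ∼⟨ ⇔-id _ ×-⇔ go ps ps-prime (odd-divisor pu-odd (n∣m*n p)) ⟩
    (SelfDivisor e p × (∀ ℓ → Prime ℓ → ℓ ∣ product ps → SelfDivisor e ℓ))
                                                            ∼⟨ primeDivisors-* (SelfDivisor e) p-prime ⟩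
    (∀ ℓ → Prime ℓ → ℓ ∣ p ℕ.* product ps → SelfDivisor e ℓ) ∎
    where open EquationalReasoning

∤⇔gcd< : ∀ e q → .{{NonZero q}} → (¬ q ∣ e) ⇔ gcd e q < q
∤⇔gcd< e q = mk⇔
  (λ q∤e → ℕₚ.≤∧≢⇒< (gcd[m,n]≤n e q) (λ g≡q → q∤e (subst (_∣ e) g≡q (gcd[m,n]∣m e q))))
  (λ g<q q∣e → ℕₚ.<-irrefl (sym (∣-antisym (gcd-greatest q∣e ∣-refl) (gcd[m,n]∣n e q))) g<q)

primewise : ∀ {n} {P Q : ℕ → Set} → (∀ p → Prime p → P p ⇔ Q p) →
            (∀ p → Prime p → p ∣ n → P p) ⇔ (∀ p → Prime p → p ∣ n → Q p)
primewise P⇔Q = mk⇔ (λ P∣n p p-prime p∣n → Equivalence.to (P⇔Q p p-prime) (P∣n p p-prime p∣n))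
                    (λ Q∣n p p-prime p∣n → Equivalence.from (P⇔Q p p-prime) (Q∣n p p-prime p∣n))

prime⇒p∸1≢0 : ∀ {p} → Prime p → NonZero (p ∸ 1)
prime⇒p∸1≢0 {zero}        p-prime = contradiction p-prime ¬prime[0]
prime⇒p∸1≢0 {suc zero}    p-prime = contradiction p-prime ¬prime[1]
prime⇒p∸1≢0 {suc (suc r)} _       = _

half : ∀ k → (suc (2 ℕ.* suc k) ∸ 1) / 2 ≡ suc k
half k = trans (cong (_/ 2) (ℕₚ.*-comm 2 (suc k))) (m*n/n≡m (suc k) 2)

mainTheorem5 : (n : ℕ) → Odd n →
    InP n ⇔ (∀ (p : ℕ) → Prime p → p ∣ n → gcd ((n ∸ 1) / 2) (p ∸ 1) < p ∸ 1)
mainTheorem5 _ (zero , refl) = mk⇔ (λ _ p p-prime p∣1 → contradiction p∣1 (prime∤1 p-prime)) (λ _ → (0 , refl) , 1∣ 0)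
mainTheorem5 n n-odd@(suc k , refl) = begin
  InP n                                            ∼⟨ mk⇔ proj₂ (n-odd ,_) ⟩
  n ∣ G n                                          ∼⟨ mk⇔ ∣ᵤ⇒∣ ∣⇒∣ᵤ ⟩
  + n ∣ᶻ + G n                                     ∼⟨ mk⇔ (subst (+ n ∣ᶻ_) G≡S) (subst (+ n ∣ᶻ_) (sym G≡S)) ⟩
  SelfDivisor e n                                  ∼⟨ localGlobal e n-odd ⟩
  (∀ p → Prime p → p ∣ n → SelfDivisor e p)        ∼⟨ primewise criterion ⟩
  (∀ p → Prime p → p ∣ n → ¬ p ∸ 1 ∣ e)            ∼⟨ primewise (λ p p-prime → ∤⇔gcd< e (p ∸ 1) {{prime⇒p∸1≢0 p-prime}}) ⟩
  (∀ p → Prime p → p ∣ n → gcd e (p ∸ 1) < p ∸ 1) ∎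
  where
  open EquationalReasoning
  e : ℕ
  e = (n ∸ 1) / 2
  G≡S : + G n ≡ S e n
  G≡S = subst (λ e → + powSum e (2 ℕ.* suc k) ≡ S e n) (sym (half k)) (powSum≡S k (2 ℕ.* suc k))
  criterion : ∀ p → Prime p → SelfDivisor e p ⇔ (¬ p ∸ 1 ∣ e)
  criterion p p-prime = subst (λ e → SelfDivisor e p ⇔ (¬ p ∸ 1 ∣ e)) (sym (half k)) (primeCriterion k p-prime)
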